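{- Every symmetric deck is maximal.
   Context: A deck consists of a finite set $S$ of symbols together with a finite collection $D$ of distinct cards, each card being a subset of $S$, satisfying: (D1) any two distinct cards have exactly one symbol in common; (D2) every symbol of $S$ lies on at least two cards; (D3) every card contains at least two symbols; (D4) all cards have the same cardinality $n$ (the order); (D5) $S$ is nonempty. The multiplicity of a symbol is the number of cards containing it; a deck is symmetric if all symbols have the same multiplicity. A deck $D$ is maximal if there is no new card $\Gamma\subseteq S$, $\Gamma\notin D$, such that $D\cup\{\Gamma\}$ (with the same symbol set $S$) is still a deck. -}

module Defs where

open import Data.Nat using (ℕ; _≤_; _>_)
open import Data.Fin using (Fin)
open import Data.Fin.Subset using (Subset; _∈_; _∉_; _∩_; ∣_∣)
open import Data.Fin.Subset.Properties using (_∈?_)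
open import Data.List using (List; _∷_; length; filter)
import Data.List.Membership.Propositional as LM
open import Data.List.Relation.Unary.Unique.Propositional using (Unique)
open import Data.Product using (_×_; ∃)
open import Relation.Binary.PropositionalEquality using (_≡_; _≢_)
open import Relation.Nullary using (¬_)

-- Symbols: the finite set S = Fin m (any finite set is in bijection with some Fin m).
-- A card is a subset of S; a collection of cards is a list of subsets
-- required to be duplicate-free (distinct cards).

multiplicity : ∀ {m} → List (Subset m) → Fin m → ℕ
multiplicity D x = length (filter (x ∈?_) D)

record IsDeck (m : ℕ) (D : List (Subset m)) : Set where
  field
    distinct : Unique D
    D1 : ∀ {c c'} → c LM.∈ D → c' LM.∈ D → c ≢ c' → ∣ c ∩ c' ∣ ≡ 1
    D2 : ∀ (x : Fin m) → 2 ≤ multiplicity D x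
    D3 : ∀ {c} → c LM.∈ D → 2 ≤ ∣ c ∣
    D4 : ∃ λ (n : ℕ) → ∀ {c} → c LM.∈ D → ∣ c ∣ ≡ n
    D5 : m > 0

IsSymmetric : ∀ {m} → List (Subset m) → Set
IsSymmetric {m} D = ∃ λ (r : ℕ) → ∀ (x : Fin m) → multiplicity D x ≡ r

IsMaximal : ∀ {m} → List (Subset m) → Set
IsMaximal {m} D = ∀ (Γ : Subset m) → ¬ (Γ LM.∈ D) → ¬ IsDeck m (Γ ∷ D)

-- Count the incidences between a set of symbols Γ and the cards of a symmetric deck of
-- multiplicity r: each symbol of Γ lies on r cards, so Σ_c |Γ ∩ c| = r |Γ|.  If Γ could be
-- added as a new card of order n, it would meet each of the cards once, giving |D| = r n.
-- For a card C already in D the same count is n + (|D| − 1) = r n, since C meets itself in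
-- n symbols.  Hence n = 1, contradicting that cards have at least two symbols.
module Submission where

open import Defs
open import Data.Fin using (Fin; zero; suc)
open import Data.Fin.Subset using (Subset; inside; outside; _∩_; ∣_∣)
open import Data.Fin.Subset.Properties using (_∈?_; ∩-idem)
open import Data.List using (List; []; _∷_; length; map)
import Data.List.Membership.Propositional as LM
import Data.List.Relation.Unary.All as All
open import Data.List.Relation.Unary.AllPairs using (_∷_)
open import Data.List.Relation.Unary.Any using (here; there)
open import Data.List.Relation.Unary.Unique.Propositional using (Unique)
open import Data.Nat using (ℕ; zero; suc; _+_; _*_; _≤_; s≤s)
open import Data.Nat.ListAction using (sum)
open import Data.Nat.Properties
  using (+-comm; +-assoc; +-suc; *-zeroʳ; *-suc; +-cancelʳ-≡; +-commutativeSemigroup)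
open import Algebra.Properties.CommutativeSemigroup +-commutativeSemigroup using (x∙yz≈y∙xz)
open import Data.Product using (_,_)
open import Data.Vec using ([]; _∷_; tail)
open import Function using (_∘_)
open import Relation.Binary.PropositionalEquality
open import Relation.Nullary using (yes; no; contradiction)

module _ {a} {A : Set a} (f : A → ℕ) where

  sum-map-ones : ∀ xs → (∀ {x} → x LM.∈ xs → f x ≡ 1) → sum (map f xs) ≡ length xs
  sum-map-ones []       ones = refl
  sum-map-ones (x ∷ xs) ones rewrite ones (here refl) = cong suc (sum-map-ones xs (ones ∘ there))

  sum-map-ones-except : ∀ {y} xs → Unique xs → y LM.∈ xs →
                        (∀ {x} → x LM.∈ xs → x ≢ y → f x ≡ 1) →
                        sum (map f xs) + 1 ≡ f y + length xs
  sum-map-ones-except (x ∷ xs) (x∉xs ∷ _) (here refl) ones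
    rewrite sum-map-ones xs (λ p → ones (there p) (λ x≡y → All.lookup x∉xs p (sym x≡y))) =
    trans (+-assoc (f x) (length xs) 1) (cong (f x +_) (+-comm (length xs) 1))
  sum-map-ones-except (x ∷ xs) (x∉xs ∷ unique) (there y∈xs) ones
    rewrite ones (here refl) (All.lookup x∉xs y∈xs) =
    trans (cong suc (sum-map-ones-except xs unique y∈xs (ones ∘ there)))
          (sym (+-suc _ (length xs)))

incidences : ∀ {m} → Subset m → List (Subset m) → ℕ
incidences Γ = sum ∘ map (λ c → ∣ Γ ∩ c ∣)

IsRegular : ∀ {m} → ℕ → List (Subset m) → Set
IsRegular {m} r L = ∀ (x : Fin m) → multiplicity L x ≡ r

incidences-[] : (L : List (Subset 0)) → incidences [] L ≡ 0
incidences-[] []       = refl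
incidences-[] ([] ∷ L) = incidences-[] L

incidences-inside : ∀ {m} (Γ : Subset m) L →
                    incidences (inside ∷ Γ) L ≡ multiplicity L zero + incidences Γ (map tail L)
incidences-inside Γ []                 = refl
incidences-inside Γ ((inside ∷ c) ∷ L) =
  cong suc (trans (cong (∣ Γ ∩ c ∣ +_) (incidences-inside Γ L))
                  (x∙yz≈y∙xz ∣ Γ ∩ c ∣ (multiplicity L zero) (incidences Γ (map tail L))))
incidences-inside Γ ((outside ∷ c) ∷ L) =
  trans (cong (∣ Γ ∩ c ∣ +_) (incidences-inside Γ L))
        (x∙yz≈y∙xz ∣ Γ ∩ c ∣ (multiplicity L zero) (incidences Γ (map tail L)))

incidences-outside : ∀ {m} (Γ : Subset m) L → incidences (outside ∷ Γ) L ≡ incidences Γ (map tail L)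
incidences-outside Γ []            = refl
incidences-outside Γ ((_ ∷ c) ∷ L) = cong (∣ Γ ∩ c ∣ +_) (incidences-outside Γ L)

multiplicity-map-tail : ∀ {m} (L : List (Subset (suc m))) x →
                        multiplicity (map tail L) x ≡ multiplicity L (suc x)
multiplicity-map-tail []            x = refl
multiplicity-map-tail ((_ ∷ c) ∷ L) x with x ∈? c
... | yes _ = cong suc (multiplicity-map-tail L x)
... | no _  = multiplicity-map-tail L x

regular-map-tail : ∀ {m r} (L : List (Subset (suc m))) → IsRegular r L → IsRegular r (map tail L)
regular-map-tail L regular x = trans (multiplicity-map-tail L x) (regular (suc x))

incidences-regular : ∀ {m r} (Γ : Subset m) L → IsRegular r L → incidences Γ L ≡ r * ∣ Γ ∣
incidences-regular {r = r} []            L regular = trans (incidences-[] L) (sym (*-zeroʳ r))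
incidences-regular {r = r} (inside ∷ Γ)  L regular = begin
  incidences (inside ∷ Γ) L                         ≡⟨ incidences-inside Γ L ⟩
  multiplicity L zero + incidences Γ (map tail L)   ≡⟨ cong₂ _+_ (regular zero)
                                                         (incidences-regular Γ (map tail L) (regular-map-tail L regular)) ⟩
  r + r * ∣ Γ ∣                                     ≡⟨ sym (*-suc r ∣ Γ ∣) ⟩
  r * ∣ inside ∷ Γ ∣                                ∎
  where open ≡-Reasoning
incidences-regular (outside ∷ Γ) L regular =
  trans (incidences-outside Γ L) (incidences-regular Γ (map tail L) (regular-map-tail L regular))

length≡r*∣Γ∣ : ∀ {m r} (Γ : Subset m) L → IsRegular r L →
               (∀ {c} → c LM.∈ L → ∣ Γ ∩ c ∣ ≡ 1) → length L ≡ r * ∣ Γ ∣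
length≡r*∣Γ∣ Γ L regular meetsOnce =
  trans (sym (sum-map-ones _ L meetsOnce)) (incidences-regular Γ L regular)

r*∣C∣+1≡∣C∣+length : ∀ {m r} (C : Subset m) L → IsRegular r L → Unique L → C LM.∈ L →
                     (∀ {c} → c LM.∈ L → c ≢ C → ∣ C ∩ c ∣ ≡ 1) → r * ∣ C ∣ + 1 ≡ ∣ C ∣ + length L
r*∣C∣+1≡∣C∣+length {r = r} C L regular unique C∈L meetsOthersOnce = begin
  r * ∣ C ∣ + 1         ≡⟨ cong (_+ 1) (sym (incidences-regular C L regular)) ⟩
  incidences C L + 1    ≡⟨ sum-map-ones-except _ L unique C∈L meetsOthersOnce ⟩
  ∣ C ∩ C ∣ + length L  ≡⟨ cong (λ c → ∣ c ∣ + length L) (∩-idem C) ⟩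
  ∣ C ∣ + length L      ∎
  where open ≡-Reasoning

mainTheorem20 : (m : ℕ) (D : List (Subset m)) → IsDeck m D → IsSymmetric D → IsMaximal D
mainTheorem20 zero    _  deck _ = contradiction (IsDeck.D5 deck) λ ()
mainTheorem20 (suc m) [] deck _ = contradiction (IsDeck.D2 deck zero) λ ()
mainTheorem20 (suc m) D@(C ∷ _) deck (r , regular) Γ Γ∉D deck′ =
  contradiction (subst (2 ≤_) (sym 1≡∣C∣) (IsDeck.D3 deck (here refl))) λ { (s≤s ()) }
  where
  open IsDeck deck′ using (D1; D4)

  ∣Γ∣≡∣C∣ : ∣ Γ ∣ ≡ ∣ C ∣
  ∣Γ∣≡∣C∣ with _ , order ← D4 = trans (order (here refl)) (sym (order (there (here refl))))

  length≡r*∣C∣ : length D ≡ r * ∣ C ∣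
  length≡r*∣C∣ = trans (length≡r*∣Γ∣ Γ D regular λ c∈D →
                          D1 (here refl) (there c∈D) λ Γ≡c → Γ∉D (subst (LM._∈ D) (sym Γ≡c) c∈D))
                       (cong (r *_) ∣Γ∣≡∣C∣)

  1≡∣C∣ : 1 ≡ ∣ C ∣
  1≡∣C∣ = +-cancelʳ-≡ (r * ∣ C ∣) 1 ∣ C ∣ (begin
    1 + r * ∣ C ∣     ≡⟨ +-comm 1 (r * ∣ C ∣) ⟩
    r * ∣ C ∣ + 1     ≡⟨ r*∣C∣+1≡∣C∣+length C D regular (IsDeck.distinct deck) (here refl)
                           (λ c∈D c≢C → IsDeck.D1 deck (here refl) c∈D (c≢C ∘ sym)) ⟩
    ∣ C ∣ + length D  ≡⟨ cong (∣ C ∣ +_) length≡r*∣C∣ ⟩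
    ∣ C ∣ + r * ∣ C ∣ ∎)
    where open ≡-Reasoning
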